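{- Let $G=(V,E)$ be a digraph and $K_1,K_2,Z\subseteq V$ be such that $K_1\cup K_2$ is $Z$-normal, $K_1\cap K_2=\emptyset$, and there is no edge with source in $K_2$ and target in $K_1$. Then for each path $\mathfrak{p}=(V_{\mathfrak{p}},E_{\mathfrak{p}})$ in $G$, $|E_{\mathfrak{p}}\cap E(K_2,V\setminus K_2)|\le 3\cdot|Z|+3$.
   Context: For disjoint $Z,K\subseteq V$, $K$ is $Z$-normal if there is no directed walk in $V\setminus Z$ with first and last vertex in $K$ that uses a vertex of $V\setminus(Z\cup K)$. A path is a directed simple path $v_1e_1\dots e_{n-1}v_n$ ($e_i$ from $v_i$ to $v_{i+1}$, pairwise distinct vertices) with vertex set $V_{\mathfrak{p}}$ and edge set $E_{\mathfrak{p}}$. For disjoint $V_1,V_2$, $E(V_1,V_2)$ is the set of edges with one endpoint in $V_1$ and the other in $V_2$. -}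

module Defs where

open import Data.Nat using (ℕ; suc)
open import Data.Bool using (Bool; _xor_)
open import Data.Fin using (Fin; zero; suc; inject₁; fromℕ; _≟_)
open import Data.Fin.Properties using (any?)
open import Data.Fin.Subset using (Subset; _∈_; _∉_; _∩_; Empty)
open import Data.Fin.Subset.Properties using (_∈?_)
open import Data.Vec using (tabulate)
open import Data.Product using (Σ; ∃; _×_)
open import Data.Empty using (⊥)
open import Function.Definitions using (Injective)
open import Relation.Binary.PropositionalEquality using (_≡_)
open import Relation.Nullary using (¬_)
open import Relation.Nullary.Decidable using (⌊_⌋)

record Digraph : Set where
  field
    n   : ℕ
    m   : ℕ
    src : Fin m → Fin n
    tgt : Fin m → Fin n

module _ (G : Digraph) where
  open Digraph G

  record Walk : Set where
    field
      len   : ℕ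
      vert  : Fin (suc len) → Fin n
      edge  : Fin len → Fin m
      src-ok : ∀ i → src (edge i) ≡ vert (inject₁ i)
      tgt-ok : ∀ i → tgt (edge i) ≡ vert (suc i)

  first last : Walk → Fin n
  first w = Walk.vert w zero
  last w = Walk.vert w (fromℕ (Walk.len w))

  record Path : Set where
    field
      walk     : Walk
      distinct : Injective _≡_ _≡_ (Walk.vert walk)

  Disjoint : Subset n → Subset n → Set
  Disjoint A B = Empty (A ∩ B)

  IsNormal : (Z K : Subset n) → Set
  IsNormal Z K =
    Disjoint Z K ×
    ((w : Walk) →
      (∀ i → Walk.vert w i ∉ Z) →
      first w ∈ K → last w ∈ K →
      ¬ (∃ λ i → Walk.vert w i ∉ Z × Walk.vert w i ∉ K))

  pathEdges : Path → Subset m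
  pathEdges p = tabulate λ e → ⌊ any? (λ i → Walk.edge (Path.walk p) i ≟ e) ⌋

  cutEdges : Subset n → Subset m
  cutEdges A = tabulate λ e → ⌊ src e ∈? A ⌋ xor ⌊ tgt e ∈? A ⌋

module Submission where

-- Label every vertex z (in Z), k (in K₂) or o (elsewhere).  Once a path leaves K₂ it cannot
-- re-enter K₂ before meeting Z: otherwise the stretch from its last K₂-vertex to the
-- re-entry is a walk in V ∖ Z between vertices of K₁ ∪ K₂ whose second vertex lies outside
-- Z ∪ K₂, and also outside K₁ as no edge goes from K₂ to K₁, contradicting normality.  So
-- the label word has no factor k o⁺ k, and such a word with j letters z changes between k
-- and non-k at most 2j + 2 times; since the path is simple, j ≤ ∣ Z ∣.

open import Defs
open import Data.Nat using (_≤_; _+_; _*_)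
open import Data.Fin.Subset using (Subset; _∈_; _∪_; _∩_; ∣_∣)
open import Data.Empty using (⊥)

open import Data.Bool using (Bool; true; false; _xor_; if_then_else_)
open import Data.Bool.Properties using (T-≡)
open import Data.Empty using (⊥-elim)
open import Data.Fin using (Fin; zero; suc; inject₁)
open import Data.Fin.Subset using (inside; outside; _∉_; _-_; _⊆_; ⁅_⁆) renaming (⊥ to ∅)
open import Data.Fin.Subset.Properties
  using ( _∈?_; x∈p⇒∣p-x∣<∣p∣; x∈p∧x≢y⇒x∈p-y; x∈p∩q⁺; x∈p∩q⁻; x∈p∪q⁺; x∈p∪q⁻
        ; p⊆q⇒∣p∣≤∣q∣; x∈⁅x⁆; ∣⊥∣≡0; ∣⁅x⁆∣≡1)
open import Data.List using (List; []; _∷_; length; filter; map; tabulate)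
open import Data.List.Relation.Unary.All as All using (All; []; _∷_)
open import Data.List.Relation.Unary.All.Properties using (all-filter)
open import Data.List.Relation.Unary.Unique.Propositional using (Unique; []; _∷_)
open import Data.List.Relation.Unary.Unique.Propositional.Properties using (filter⁺; tabulate⁺)
open import Data.Nat using (ℕ; zero; suc; z≤n; s≤s)
open import Data.Nat.Properties
open import Data.Product using (Σ; _×_; _,_; proj₁; proj₂)
open import Data.Sum using (_⊎_; inj₁; inj₂)
open import Data.Unit using (⊤; tt)
open import Data.Vec using (_∷_; [])
import Data.Vec as Vec
open import Data.Vec.Properties using ([]=⇒lookup; lookup∘tabulate)
open import Function using (_∘_)
open import Function.Bundles using (Equivalence)
open import Function.Definitions using (Injective)
open import Relation.Binary.PropositionalEquality
  using (_≡_; _≢_; refl; sym; trans; cong; cong₂; subst; module ≡-Reasoning)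
open import Relation.Nullary using (¬_; Dec; yes; no; does)
open import Relation.Nullary.Decidable using (⌊_⌋; toWitness)
open import Relation.Unary using (Pred; Decidable)

∣p∪q∣≤∣p∣+∣q∣ : ∀ {n} (p q : Subset n) → ∣ p ∪ q ∣ ≤ ∣ p ∣ + ∣ q ∣
∣p∪q∣≤∣p∣+∣q∣ []            []            = z≤n
∣p∪q∣≤∣p∣+∣q∣ (outside ∷ p) (outside ∷ q) = ∣p∪q∣≤∣p∣+∣q∣ p q
∣p∪q∣≤∣p∣+∣q∣ (outside ∷ p) (inside  ∷ q) =
  ≤-trans (s≤s (∣p∪q∣≤∣p∣+∣q∣ p q)) (≤-reflexive (sym (+-suc ∣ p ∣ ∣ q ∣)))
∣p∪q∣≤∣p∣+∣q∣ (inside  ∷ p) (outside ∷ q) = s≤s (∣p∪q∣≤∣p∣+∣q∣ p q)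
∣p∪q∣≤∣p∣+∣q∣ (inside  ∷ p) (inside  ∷ q) =
  s≤s (≤-trans (∣p∪q∣≤∣p∣+∣q∣ p q) (+-monoʳ-≤ ∣ p ∣ (n≤1+n ∣ q ∣)))

length≤∣p∣ : ∀ {n} {p : Subset n} {xs} → Unique xs → All (_∈ p) xs → length xs ≤ ∣ p ∣
length≤∣p∣ []                 []              = z≤n
length≤∣p∣ {p = p} {x ∷ xs} (x≢xs ∷ unique-xs) (x∈p ∷ xs⊆p) =
  ≤-trans (s≤s (length≤∣p∣ unique-xs xs⊆p-x)) (x∈p⇒∣p-x∣<∣p∣ x∈p)
  where
  xs⊆p-x : All (_∈ p - x) xs
  xs⊆p-x = All.zipWith (λ (x≢y , y∈p) → x∈p∧x≢y⇒x∈p-y y∈p (x≢y ∘ sym)) (x≢xs , xs⊆p)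

∈-tabulate⁻ : ∀ {n} {f : Fin n → Bool} {x} → x ∈ Vec.tabulate f → f x ≡ true
∈-tabulate⁻ {f = f} {x} x∈ = trans (sym (lookup∘tabulate f x)) ([]=⇒lookup x∈)

∣if⁅x⁆∣ : ∀ {n} b (x : Fin n) → ∣ if b then ⁅ x ⁆ else ∅ ∣ ≡ (if b then 1 else 0)
∣if⁅x⁆∣     true  x = ∣⁅x⁆∣≡1 x
∣if⁅x⁆∣ {n} false x = ∣⊥∣≡0 n

length-filter-map : ∀ {a b p} {A : Set a} {B : Set b} {P : Pred B p}
                    (P? : Decidable P) (f : A → B) xs →
                    length (filter P? (map f xs)) ≡ length (filter (P? ∘ f) xs)
length-filter-map P? f []       = refl
length-filter-map P? f (x ∷ xs) with does (P? (f x))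
... | true  = cong suc (length-filter-map P? f xs)
... | false = length-filter-map P? f xs

data Label : Set where
  z k o : Label

isK : Label → Bool
isK k = true
isK _ = false

isZ? : Decidable (_≡ z)
isZ? z = yes refl
isZ? k = no λ ()
isZ? o = no λ ()

crossing : Label → Label → ℕ
crossing a b = if isK a xor isK b then 1 else 0

crossings : List Label → ℕ
crossings (a ∷ b ∷ w) = crossing a b + crossings (b ∷ w)
crossings _           = 0

zeros : List Label → ℕ
zeros w = length (filter isZ? w)

StartsWithK : List Label → Set
StartsWithK []      = ⊥
StartsWithK (a ∷ _) = a ≡ k

Returning : List Label → Set
Returning []      = ⊥
Returning (a ∷ w) = a ≡ o × (StartsWithK w ⊎ Returning w)

ReturnFree : List Label → Set
ReturnFree []      = ⊤
ReturnFree (a ∷ w) = (a ≡ k → ¬ Returning w) × ReturnFree w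

-- How a word begins, as seen by a letter put in front of it: with k, with o⁺ k, or otherwise.
data Front : Set where
  atK returning free : Front

leave : Front → Front
leave free = free
leave _    = returning

front : List Label → Front
front []      = free
front (z ∷ _) = free
front (k ∷ _) = atK
front (o ∷ w) = leave (front w)

slack : Front → ℕ
slack atK       = 1
slack returning = 2
slack free      = 0

slack≤2 : ∀ f → slack f ≤ 2
slack≤2 atK       = s≤s z≤n
slack≤2 returning = ≤-refl
slack≤2 free      = z≤n

leave-idem : ∀ f → leave (leave f) ≡ leave f
leave-idem atK       = refl
leave-idem returning = refl
leave-idem free      = refl

front≡returning⇒Returning : ∀ w → front w ≡ returning → Returning w
front≡returning⇒Returning (o ∷ k ∷ w) _  = refl , inj₁ refl
front≡returning⇒Returning (o ∷ o ∷ w) eq =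
  refl , inj₂ (front≡returning⇒Returning (o ∷ w) (trans (sym (leave-idem (front w))) eq))
front≡returning⇒Returning (o ∷ z ∷ w) ()
front≡returning⇒Returning (o ∷ [])    ()
front≡returning⇒Returning (k ∷ w)     ()
front≡returning⇒Returning (z ∷ w)     ()
front≡returning⇒Returning []          ()

crossing-z+slack≤2 : ∀ b w → crossing z b + slack (front (b ∷ w)) ≤ 2
crossing-z+slack≤2 z w = z≤n
crossing-z+slack≤2 k w = ≤-refl
crossing-z+slack≤2 o w = slack≤2 (front (o ∷ w))

crossings≤slack+2*zeros : ∀ w → ReturnFree w → crossings w ≤ slack (front w) + 2 * zeros w
crossings≤slack+2*zeros []          _ = z≤n
crossings≤slack+2*zeros (_ ∷ [])    _ = z≤n
crossings≤slack+2*zeros (a ∷ b ∷ w) (no-return , return-free) =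
  extend a b no-return (crossings≤slack+2*zeros (b ∷ w) return-free)
  where
  extend : ∀ a b {c} → (a ≡ k → ¬ Returning (b ∷ w)) →
           c ≤ slack (front (b ∷ w)) + 2 * zeros (b ∷ w) →
           crossing a b + c ≤ slack (front (a ∷ b ∷ w)) + 2 * zeros (a ∷ b ∷ w)
  extend k k _ ih = ih
  extend k z _ ih = s≤s ih
  extend k o no-return ih with front w | front≡returning⇒Returning (o ∷ w)
  ... | free      | _   = s≤s ih
  ... | atK       | ret = ⊥-elim (no-return refl (ret refl))
  ... | returning | ret = ⊥-elim (no-return refl (ret refl))
  extend o k _ ih = s≤s ih
  extend o z _ ih = ih
  extend o o _ ih rewrite leave-idem (front w) = ih
  extend z b {c} _ ih = begin
    crossing z b + c                                            ≤⟨ +-monoʳ-≤ (crossing z b) ih ⟩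
    crossing z b + (slack (front (b ∷ w)) + 2 * zeros (b ∷ w))  ≡⟨ +-assoc (crossing z b) _ _ ⟨
    crossing z b + slack (front (b ∷ w)) + 2 * zeros (b ∷ w)    ≤⟨ +-monoˡ-≤ _ (crossing-z+slack≤2 b w) ⟩
    2 + 2 * zeros (b ∷ w)                                       ≡⟨ *-suc 2 (zeros (b ∷ w)) ⟨
    2 * suc (zeros (b ∷ w))                                     ∎
    where open ≤-Reasoning

crossings≤2+2*zeros : ∀ w → ReturnFree w → crossings w ≤ 2 + 2 * zeros w
crossings≤2+2*zeros w return-free =
  ≤-trans (crossings≤slack+2*zeros w return-free) (+-monoˡ-≤ (2 * zeros w) (slack≤2 (front w)))

module Walks (G : Digraph) where
  open Digraph G

  stay : Fin n → Walk G
  stay u = record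
    { len = 0 ; vert = λ _ → u ; edge = λ () ; src-ok = λ () ; tgt-ok = λ () }

  prepend : (u : Fin n) (e : Fin m) → src e ≡ u → (w : Walk G) → tgt e ≡ first G w → Walk G
  prepend u e src≡u w tgt≡first = record
    { len    = suc (Walk.len w)
    ; vert   = λ { zero → u ; (suc i) → Walk.vert w i }
    ; edge   = λ { zero → e ; (suc i) → Walk.edge w i }
    ; src-ok = λ { zero → src≡u ; (suc i) → Walk.src-ok w i }
    ; tgt-ok = λ { zero → tgt≡first ; (suc i) → Walk.tgt-ok w i }
    }

  Joins : ∀ {l} → (Fin (suc l) → Fin n) → (Fin l → Fin m) → Set
  Joins v es = ∀ i → src (es i) ≡ v (inject₁ i) × tgt (es i) ≡ v (suc i)

  walk-joins : ∀ (w : Walk G) → Joins (Walk.vert w) (Walk.edge w)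
  walk-joins w i = Walk.src-ok w i , Walk.tgt-ok w i

  Avoids : Subset n → Walk G → Set
  Avoids Z w = ∀ i → Walk.vert w i ∉ Z

module _ {a b} {A : Set a} {B : Set b} where

  classify : Dec A → Dec B → Label
  classify (yes _) _       = z
  classify (no _)  (yes _) = k
  classify (no _)  (no _)  = o

  classify≡z⇒A : ∀ A? B? → classify A? B? ≡ z → A
  classify≡z⇒A (yes x) _      _  = x
  classify≡z⇒A (no _) (yes _) ()
  classify≡z⇒A (no _) (no _)  ()

  classify≡k⇒¬A×B : ∀ A? B? → classify A? B? ≡ k → ¬ A × B
  classify≡k⇒¬A×B (no ¬x) (yes y) _ = ¬x , y
  classify≡k⇒¬A×B (yes _) _       ()
  classify≡k⇒¬A×B (no _)  (no _)  ()

  classify≡o⇒¬A×¬B : ∀ A? B? → classify A? B? ≡ o → ¬ A × ¬ B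
  classify≡o⇒¬A×¬B (no ¬x) (no ¬y) _ = ¬x , ¬y
  classify≡o⇒¬A×¬B (yes _) _       ()
  classify≡o⇒¬A×¬B (no _)  (yes _) ()

  isK∘classify : ¬ (A × B) → ∀ A? B? → isK (classify A? B?) ≡ ⌊ B? ⌋
  isK∘classify ¬A×B (yes x) (yes y) = ⊥-elim (¬A×B (x , y))
  isK∘classify _    (yes _) (no _)  = refl
  isK∘classify _    (no _)  (yes _) = refl
  isK∘classify _    (no _)  (no _)  = refl

module Labelling (G : Digraph) (Z K : Subset (Digraph.n G)) where
  open Digraph G
  open Walks G

  label : Fin n → Label
  label u = classify (u ∈? Z) (u ∈? K)

  labels : ∀ {l} → (Fin l → Fin n) → List Label
  labels v = map label (tabulate v)

  label≡z⇒∈Z : ∀ {u} → label u ≡ z → u ∈ Z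
  label≡z⇒∈Z {u} = classify≡z⇒A (u ∈? Z) (u ∈? K)

  label≡k⇒∉Z×∈K : ∀ {u} → label u ≡ k → u ∉ Z × u ∈ K
  label≡k⇒∉Z×∈K {u} = classify≡k⇒¬A×B (u ∈? Z) (u ∈? K)

  label≡o⇒∉Z×∉K : ∀ {u} → label u ≡ o → u ∉ Z × u ∉ K
  label≡o⇒∉Z×∉K {u} = classify≡o⇒¬A×¬B (u ∈? Z) (u ∈? K)

  isK∘label : Disjoint G Z K → ∀ u → isK (label u) ≡ ⌊ u ∈? K ⌋
  isK∘label Z∩K=∅ u =
    isK∘classify (λ (u∈Z , u∈K) → Z∩K=∅ (u , x∈p∩q⁺ (u∈Z , u∈K))) (u ∈? Z) (u ∈? K)

  returning-walk : ∀ {l} (v : Fin (suc l) → Fin n) es → Joins v es → Returning (labels v) →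
                   Σ (Walk G) λ w → first G w ≡ v zero × last G w ∈ K × Avoids Z w
  returning-walk {zero}  v es joins (_ , inj₁ ())
  returning-walk {zero}  v es joins (_ , inj₂ ())
  returning-walk {suc l} v es joins (v₀≡o , inj₁ v₁≡k) =
    W , refl , proj₂ (label≡k⇒∉Z×∈K v₁≡k) , avoids
    where
    W : Walk G
    W = prepend (v zero) (es zero) (proj₁ (joins zero)) (stay (v (suc zero))) (proj₂ (joins zero))
    avoids : Avoids Z W
    avoids zero       = proj₁ (label≡o⇒∉Z×∉K v₀≡o)
    avoids (suc zero) = proj₁ (label≡k⇒∉Z×∈K v₁≡k)
  returning-walk {suc l} v es joins (v₀≡o , inj₂ returning-tail)
    with returning-walk (v ∘ suc) (es ∘ suc) (joins ∘ suc) returning-tail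
  ... | w , first≡ , last∈K , w-avoids = W , refl , last∈K , avoids
    where
    W : Walk G
    W = prepend (v zero) (es zero) (proj₁ (joins zero)) w (trans (proj₂ (joins zero)) (sym first≡))
    avoids : Avoids Z W
    avoids zero    = proj₁ (label≡o⇒∉Z×∉K v₀≡o)
    avoids (suc i) = w-avoids i

  crosses : Fin m → Bool
  crosses e = ⌊ src e ∈? K ⌋ xor ⌊ tgt e ∈? K ⌋

  cut⁅_⁆ : Fin m → Subset m
  cut⁅ e ⁆ = if crosses e then ⁅ e ⁆ else ∅

  ∣cut⁅e⁆∣≡crossing : Disjoint G Z K → ∀ e → ∣ cut⁅ e ⁆ ∣ ≡ crossing (label (src e)) (label (tgt e))
  ∣cut⁅e⁆∣≡crossing Z∩K=∅ e = begin
    ∣ cut⁅ e ⁆ ∣                                ≡⟨ ∣if⁅x⁆∣ (crosses e) e ⟩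
    (if crosses e then 1 else 0)                ≡⟨ cong (if_then 1 else 0) isK-crosses ⟨
    crossing (label (src e)) (label (tgt e))    ∎
    where
    open ≡-Reasoning
    isK-crosses : isK (label (src e)) xor isK (label (tgt e)) ≡ crosses e
    isK-crosses = cong₂ _xor_ (isK∘label Z∩K=∅ (src e)) (isK∘label Z∩K=∅ (tgt e))

  cutEdgesAlong : ∀ {l} → (Fin l → Fin m) → Subset m
  cutEdgesAlong {zero}  es = ∅
  cutEdgesAlong {suc l} es = cut⁅ es zero ⁆ ∪ cutEdgesAlong (es ∘ suc)

  ∈-cutEdgesAlong : ∀ {l} (es : Fin l → Fin m) i → crosses (es i) ≡ true → es i ∈ cutEdgesAlong es
  ∈-cutEdgesAlong es zero    crosses≡true rewrite crosses≡true = x∈p∪q⁺ (inj₁ (x∈⁅x⁆ (es zero)))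
  ∈-cutEdgesAlong es (suc i) crosses≡true =
    x∈p∪q⁺ (inj₂ (∈-cutEdgesAlong (es ∘ suc) i crosses≡true))

  ∣cutEdgesAlong∣≤crossings : Disjoint G Z K → ∀ {l} (v : Fin (suc l) → Fin n) es → Joins v es →
                              ∣ cutEdgesAlong es ∣ ≤ crossings (labels v)
  ∣cutEdgesAlong∣≤crossings Z∩K=∅ {zero}  v es joins = ≤-reflexive (∣⊥∣≡0 m)
  ∣cutEdgesAlong∣≤crossings Z∩K=∅ {suc l} v es joins =
    ≤-trans (∣p∪q∣≤∣p∣+∣q∣ cut⁅ es zero ⁆ (cutEdgesAlong (es ∘ suc)))
            (+-mono-≤ (≤-reflexive first-step)
                      (∣cutEdgesAlong∣≤crossings Z∩K=∅ (v ∘ suc) (es ∘ suc) (joins ∘ suc)))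
    where
    first-step : ∣ cut⁅ es zero ⁆ ∣ ≡ crossing (label (v zero)) (label (v (suc zero)))
    first-step = trans (∣cut⁅e⁆∣≡crossing Z∩K=∅ (es zero))
                       (cong₂ (λ x y → crossing (label x) (label y))
                              (proj₁ (joins zero)) (proj₂ (joins zero)))

  zeros-labels≤∣Z∣ : ∀ {l} (v : Fin l → Fin n) → Injective _≡_ _≡_ v → zeros (labels v) ≤ ∣ Z ∣
  zeros-labels≤∣Z∣ v v-injective = begin
    zeros (labels v)                              ≡⟨ length-filter-map isZ? label (tabulate v) ⟩
    length (filter (isZ? ∘ label) (tabulate v))   ≤⟨ length≤∣p∣ unique zs⊆Z ⟩
    ∣ Z ∣                                         ∎
    where
    open ≤-Reasoning
    unique : Unique (filter (isZ? ∘ label) (tabulate v))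
    unique = filter⁺ (isZ? ∘ label) (tabulate⁺ v-injective)
    zs⊆Z : All (_∈ Z) (filter (isZ? ∘ label) (tabulate v))
    zs⊆Z = All.map label≡z⇒∈Z (all-filter (isZ? ∘ label) (tabulate v))

  pathEdges∩cutEdges⊆cutEdgesAlong : ∀ (p : Path G) →
    pathEdges G p ∩ cutEdges G K ⊆ cutEdgesAlong (Walk.edge (Path.walk p))
  pathEdges∩cutEdges⊆cutEdgesAlong p {e} e∈ with x∈p∩q⁻ (pathEdges G p) (cutEdges G K) e∈
  ... | e∈p , e∈cut with toWitness (Equivalence.from T-≡ (∈-tabulate⁻ e∈p))
  ...   | i , refl = ∈-cutEdgesAlong (Walk.edge (Path.walk p)) i (∈-tabulate⁻ e∈cut)

  normal⇒Z∩K=∅ : ∀ {K₁} → IsNormal G Z (K₁ ∪ K) → Disjoint G Z K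
  normal⇒Z∩K=∅ normal (u , u∈Z∩K) with x∈p∩q⁻ Z K u∈Z∩K
  ... | u∈Z , u∈K = proj₁ normal (u , x∈p∩q⁺ (u∈Z , x∈p∪q⁺ (inj₂ u∈K)))

  labels-returnFree : ∀ {K₁} → IsNormal G Z (K₁ ∪ K) → (∀ e → src e ∈ K → tgt e ∈ K₁ → ⊥) →
                      ∀ {l} (v : Fin (suc l) → Fin n) es → Joins v es → ReturnFree (labels v)
  labels-returnFree normal no-back-edge {zero}  v es joins = (λ _ ()) , tt
  labels-returnFree {K₁} normal no-back-edge {suc l} v es joins =
    no-return , labels-returnFree normal no-back-edge (v ∘ suc) (es ∘ suc) (joins ∘ suc)
    where
    no-return : label (v zero) ≡ k → ¬ Returning (labels (v ∘ suc))
    no-return v₀≡k leaves@(v₁≡o , _)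
      with returning-walk (v ∘ suc) (es ∘ suc) (joins ∘ suc) leaves
    ... | w , first≡v₁ , last∈K , w-avoids =
      proj₂ normal W avoids (x∈p∪q⁺ (inj₂ v₀∈K)) (x∈p∪q⁺ (inj₂ last∈K))
            (suc zero , subst (_∉ Z) (sym first≡v₁) v₁∉Z
                      , subst (_∉ K₁ ∪ K) (sym first≡v₁) v₁∉K₁∪K)
      where
      v₀∈K : v zero ∈ K
      v₀∈K = proj₂ (label≡k⇒∉Z×∈K v₀≡k)
      v₁∉Z : v (suc zero) ∉ Z
      v₁∉Z = proj₁ (label≡o⇒∉Z×∉K v₁≡o)
      W : Walk G
      W = prepend (v zero) (es zero) (proj₁ (joins zero)) w (trans (proj₂ (joins zero)) (sym first≡v₁))
      avoids : Avoids Z W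
      avoids zero    = proj₁ (label≡k⇒∉Z×∈K v₀≡k)
      avoids (suc i) = w-avoids i
      v₁∉K₁∪K : v (suc zero) ∉ K₁ ∪ K
      v₁∉K₁∪K v₁∈ with x∈p∪q⁻ K₁ K v₁∈
      ... | inj₁ v₁∈K₁ = no-back-edge (es zero) (subst (_∈ K) (sym (proj₁ (joins zero))) v₀∈K)
                                                (subst (_∈ K₁) (sym (proj₂ (joins zero))) v₁∈K₁)
      ... | inj₂ v₁∈K  = proj₂ (label≡o⇒∉Z×∉K v₁≡o) v₁∈K

proposition5 : (G : Digraph) (K₁ K₂ Z : Subset (Digraph.n G)) →
    IsNormal G Z (K₁ ∪ K₂) →
    Disjoint G K₁ K₂ →
    (∀ e → Digraph.src G e ∈ K₂ → Digraph.tgt G e ∈ K₁ → ⊥) →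
    (p : Path G) →
    ∣ pathEdges G p ∩ cutEdges G K₂ ∣ ≤ 3 * ∣ Z ∣ + 3
proposition5 G K₁ K₂ Z normal _ no-back-edge p = begin
  ∣ pathEdges G p ∩ cutEdges G K₂ ∣ ≤⟨ p⊆q⇒∣p∣≤∣q∣ (pathEdges∩cutEdges⊆cutEdgesAlong p) ⟩
  ∣ cutEdgesAlong edge ∣            ≤⟨ ∣cutEdgesAlong∣≤crossings Z∩K₂=∅ vert edge joins ⟩
  crossings (labels vert)           ≤⟨ crossings≤2+2*zeros (labels vert) return-free ⟩
  2 + 2 * zeros (labels vert)       ≤⟨ +-monoʳ-≤ 2 (*-monoʳ-≤ 2 zeros≤∣Z∣) ⟩
  2 + 2 * ∣ Z ∣                     ≡⟨ +-comm 2 (2 * ∣ Z ∣) ⟩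
  2 * ∣ Z ∣ + 2                     ≤⟨ +-mono-≤ (*-monoˡ-≤ ∣ Z ∣ (n≤1+n 2)) (n≤1+n 2) ⟩
  3 * ∣ Z ∣ + 3                     ∎
  where
  open Walk (Path.walk p)
  open Walks G
  open Labelling G Z K₂
  open ≤-Reasoning
  joins : Joins vert edge
  joins = walk-joins (Path.walk p)
  Z∩K₂=∅ : Disjoint G Z K₂
  Z∩K₂=∅ = normal⇒Z∩K=∅ normal
  zeros≤∣Z∣ : zeros (labels vert) ≤ ∣ Z ∣
  zeros≤∣Z∣ = zeros-labels≤∣Z∣ vert (Path.distinct p)
  return-free : ReturnFree (labels vert)
  return-free = labels-returnFree normal no-back-edge vert edge joins
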